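{- With the notation of the context, the matrices $B_{a,b,c}$ for $(a,b,c)\in[0,d]^3$ with $a\oplus b\le_2c\le_2a\odot b$ are pairwise distinct and form an $\mathbb F$-basis of $\mathbb T$; in particular this basis has cardinality $|\{(a,b,c): a\oplus b\le_2c\le_2a\odot b\}|$.
   Context: Let $n\ge1$ and let $\mathbb U_1,\dots,\mathbb U_n$ be finite sets with $|\mathbb U_a|=u_a\ge2$. Put $\mathbb X=\prod_a\mathbb U_a$, $d=2^n-1$. For $g\in[0,d]$ with binary expansion $g=\sum_{a=1}^n g_{(a)}2^{a-1}$ let $\mathbb P(g)=\{a:g_{(a)}=1\}$ (a bijection between $[0,d]$ and subsets of $[1,n]$), and $R_g=\{(\mathbf u,\mathbf v)\in\mathbb X^2:\mathbf u_a\ne\mathbf v_a\iff a\in\mathbb P(g)\}$ (factorial association scheme). For $g,h\in[0,d]$: $g\le_2h$ iff $\mathbb P(g)\subseteq\mathbb P(h)$; $g\cup h,g\cap h,g\setminus h$ are the elements whose $\mathbb P$ is the union, intersection, difference of $\mathbb P(g),\mathbb P(h)$; $g\oplus h=(g\setminus h)\cup(h\setminus g)$; $\widetilde g$ has $\mathbb P(\widetilde g)=\{a\in\mathbb P(g):u_a>2\}$; $g\odot h=(g\oplus h)\cup\widetilde{g\cap h}$. $\mathbb F$ is a field; $A_g$ is the $\{0,1\}$ adjacency matrix of $R_g$ in $M_{\mathbb X}(\mathbb F)$; fixing $\mathbf x\in\mathbb X$, $E_g^*$ is the diagonal $\{0,1\}$-matrix with $E_g^*(\mathbf u,\mathbf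 u)=1$ iff $(\mathbf x,\mathbf u)\in R_g$; $\mathbb T$ is the subalgebra of $M_{\mathbb X}(\mathbb F)$ generated by all $A_g,E_g^*$. For $g,h,i\in[0,d]$, $B_{g,h,i}=\sum_{j:\ g\oplus i\le_2j\le_2h}E_g^*A_jE_i^*$. -}

module Defs where

open import Level using (Level; _⊔_) renaming (suc to lsuc)
open import Data.Nat using (ℕ; zero; suc; _<_)
open import Data.Nat.Properties using (_<?_)
open import Data.Fin using (Fin; zero; suc)
open import Data.Fin.Properties using (all?) renaming (_≟_ to _≟F_)
open import Data.Fin.Subset using (Subset; _∪_; _∩_; _─_; _⊆_; inside; outside)
open import Data.Fin.Subset.Properties using (_⊆?_)
open import Data.Vec using (Vec; []; _∷_; tabulate)
open import Data.Vec.Properties using (≡-dec)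
open import Data.Bool using (Bool; true; false; if_then_else_; _∧_)
open import Data.Bool.Properties using () renaming (_≟_ to _≟B_)
open import Data.Product using (∃)
open import Relation.Nullary using (¬_; does)
open import Algebra.Bundles using (CommutativeRing)

record Field (c ℓ : Level) : Set (lsuc (c ⊔ ℓ)) where
  field
    commutativeRing : CommutativeRing c ℓ
  open CommutativeRing commutativeRing public
  field
    0≉1     : ¬ (0# ≈ 1#)
    inverse : ∀ x → ¬ (x ≈ 0#) → ∃ λ y → (x * y) ≈ 1#

-- Index sets [0,d] are represented via the bijection P, i.e. directly
-- as subsets of [1,n]  (Subset n = Vec Bool n, position a-1 <-> a).

module SubsetOps {n : ℕ} (u : Fin n → ℕ) where

  _⊕_ : Subset n → Subset n → Subset n
  g ⊕ h = (g ─ h) ∪ (h ─ g)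

  tilde : Subset n → Subset n
  tilde g = tabulate (λ a → Data.Vec.lookup g a ∧ does (2 <? u a))

  _⊙_ : Subset n → Subset n → Subset n
  g ⊙ h = (g ⊕ h) ∪ tilde (g ∩ h)

module FAS {c ℓ : Level} (F : Field c ℓ) (n : ℕ) (u : Fin n → ℕ) where

  open Field F using (Carrier; _≈_; _+_; _*_; 0#; 1#)
  open SubsetOps u public

  X : Set
  X = (a : Fin n) → Fin (u a)

  Mat : Set c
  Mat = X → X → Carrier

  sumFin : (m : ℕ) → (Fin m → Carrier) → Carrier
  sumFin zero    f = 0#
  sumFin (suc m) f = f zero + sumFin m (λ k → f (suc k))

  sumΠ : (m : ℕ) (v : Fin m → ℕ) → (((a : Fin m) → Fin (v a)) → Carrier) → Carrier
  sumΠ zero    v f = f (λ ())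
  sumΠ (suc m) v f =
    sumFin (v zero) (λ k → sumΠ m (λ a → v (suc a))
      (λ w → f (λ { zero → k ; (suc a) → w a })))

  sumX : (X → Carrier) → Carrier
  sumX = sumΠ n u

  sumSub : (m : ℕ) → (Subset m → Carrier) → Carrier
  sumSub zero    f = f []
  sumSub (suc m) f = sumSub m (λ s → f (outside ∷ s)) + sumSub m (λ s → f (inside ∷ s))

  _≈M_ : Mat → Mat → Set ℓ
  M ≈M N = ∀ p q → M p q ≈ N p q

  0M : Mat
  0M _ _ = 0#

  _+M_ : Mat → Mat → Mat
  (M +M N) p q = M p q + N p q

  _·M_ : Carrier → Mat → Mat
  (s ·M M) p q = s * M p q

  _*M_ : Mat → Mat → Mat
  (M *M N) p q = sumX (λ r → M p r * N r q)

  indicator : Bool → Carrier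
  indicator true  = 1#
  indicator false = 0#

  eqX : X → X → Bool
  eqX p q = does (all? (λ a → p a ≟F q a))

  1M : Mat
  1M p q = indicator (eqX p q)

  -- the set of coordinates where p and q differ; (p,q) ∈ R_g iff diffSet p q ≡ g
  diffSet : X → X → Subset n
  diffSet p q = tabulate (λ a → if does (p a ≟F q a) then outside else inside)

  inR : Subset n → X → X → Bool
  inR g p q = does (≡-dec _≟B_ (diffSet p q) g)

  A : Subset n → Mat
  A g p q = indicator (inR g p q)

  E* : X → Subset n → Mat
  E* x g p q = indicator (eqX p q ∧ inR g x p)

  B : X → Subset n → Subset n → Subset n → Mat
  B x g h i p q =
    sumSub n (λ j → if does ((g ⊕ i) ⊆? j) ∧ does (j ⊆? h)
                     then ((E* x g *M A j) *M E* x i) p q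
                     else 0#)

  -- the Terwilliger algebra T: the F-subalgebra of M_X(F) generated by
  -- all A_g and E*_g (closed under ≈M, since entries live in a setoid)
  data InT (x : X) : Mat → Set (c ⊔ ℓ) where
    genA  : ∀ g → InT x (A g)
    genE  : ∀ g → InT x (E* x g)
    one   : InT x 1M
    zer   : InT x 0M
    add   : ∀ {M N} → InT x M → InT x N → InT x (M +M N)
    scal  : ∀ s {M} → InT x M → InT x (s ·M M)
    mul   : ∀ {M N} → InT x M → InT x N → InT x (M *M N)
    resp  : ∀ {M N} → M ≈M N → InT x M → InT x N

  Cond : Subset n → Subset n → Subset n → Set
  Cond a b c' = ((a ⊕ b) ⊆ c') Data.Product.× (c' ⊆ (a ⊙ b))

  cond : Subset n → Subset n → Subset n → Bool
  cond a b c' = does ((a ⊕ b) ⊆? c') ∧ does (c' ⊆? (a ⊙ b))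

  sumMat : (Subset n → Mat) → Mat
  sumMat f p q = sumSub n (λ s → f s p q)

  linComb : X → (Subset n → Subset n → Subset n → Carrier) → Mat
  linComb x coef =
    sumMat (λ a → sumMat (λ b → sumMat (λ c' →
      if cond a b c' then coef a b c' ·M B x a b c' else 0M)))

{-# OPTIONS --safe #-}
module Submission where

open import Defs
open import Level using (Level)
import Algebra.Properties.CommutativeMonoid.Sum as CommutativeMonoidSum
import Algebra.Properties.CommutativeSemigroup as CommutativeSemigroupProperties
open import Data.Bool using (Bool; true; false; if_then_else_; _∧_; _∨_; _xor_)
open import Data.Bool.Base as Bool using (f≤t; b≤b)
open import Data.Bool.Properties using (≤-minimum) renaming (_≟_ to _≟ᵇ_)
open import Data.Empty using (⊥-elim)
open import Data.Fin using (Fin; zero; suc; punchIn)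
open import Data.Fin.Properties using (_≟_; all?; suc-injective; punchInᵢ≢i; punchIn-injective)
open import Data.Fin.Permutation using (Permutation′; _⟨$⟩ʳ_; _⟨$⟩ˡ_; inverseˡ; transpose; _∘ₚ_)
import Data.Fin.Permutation.Components as PC
open import Data.Fin.Subset using (Subset; outside; inside; _⊆_; _⊈_; _⊂_; _⊃_; _∪_; _∩_; _─_)
open import Data.Fin.Subset.Induction using (⊃-wellFounded; Acc; acc)
open import Data.Fin.Subset.Properties
  using (_⊆?_; ⊆-refl; ⊆-antisym; drop-∷-⊆; out⊆; in⊆in; out⊂in; in⊂in; out⊂out-⇔)
open import Data.Nat as ℕ using (ℕ; _≤_; _<_; _<?_; s≤s; z≤n)
open import Data.Product using (_×_; _,_; ∃; ∃₂; proj₁; proj₂)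
open import Data.Sum using (_⊎_; inj₁; inj₂)
open import Data.Vec using ([]; _∷_; lookup; here)
open import Data.Vec.Properties
  using (≡-dec; ∷-injectiveʳ; lookup-zipWith; lookup∘tabulate; tabulate-cong; tabulate∘lookup; lookup⇒[]=; []=⇒lookup)
open import Function using (_∘_; id; const; case_of_)
open import Function.Bundles using (_⇔_; mk⇔; Equivalence)
open import Relation.Binary.Definitions using (DecidableEquality)
open import Relation.Binary.PropositionalEquality as ≡ using (_≡_; _≢_)
open import Relation.Nullary using (Dec; does; yes; no; ¬_; _×-dec_)
open import Relation.Nullary.Decidable using (dec-true; dec-false; does-⇔)

open Equivalence using (to; from)

-- Call (diffSet x p, diffSet p q, diffSet x q) the type of a pair (p, q) of vertices. Coordinatewise it
-- records which of x_a, p_a, q_a coincide, so the types that occur are exactly the triples satisfying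
-- Cond (all three can differ only where u_a > 2). The entry B_{a,b,c}(p, q) is 1 exactly when (p, q) has
-- type (a, d, c) with d ⊆ b. Evaluating at a pair of type (a, b, c) separates the B's and, by downward
-- induction on b, shows that they are independent. Conversely every matrix in T is invariant under the
-- coordinatewise permutations fixing x, which act transitively on the pairs of each type; so its entries
-- depend only on the type, and Möbius inversion over b expresses it in terms of the B's.

-- Triangle Third a b c: (a, b, c) is ([x ≠ p], [p ≠ q], [x ≠ q]) for points x, p, q of a set,
-- which can be pairwise distinct only given Third, a witness that the set has a third element.
data Triangle (Third : Set) : Bool → Bool → Bool → Set where
  all-equal    : Triangle Third false false false
  x≡p          : Triangle Third false true true
  p≡q          : Triangle Third true false true
  x≡q          : Triangle Third true true false
  all-distinct : Third → Triangle Third true true true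

Triangle⇔ : ∀ {Third a b c} (third? : Dec Third) →
            Triangle Third a b c ⇔ (a xor b Bool.≤ c × c Bool.≤ (a xor b) ∨ (a ∧ b) ∧ does third?)
Triangle⇔ {Third} third? = mk⇔ to′ (from′ third?)
  where
  to′ : ∀ {a b c} → Triangle Third a b c → a xor b Bool.≤ c × c Bool.≤ (a xor b) ∨ (a ∧ b) ∧ does third?
  to′ all-equal        = b≤b , b≤b
  to′ x≡p              = b≤b , b≤b
  to′ p≡q              = b≤b , b≤b
  to′ x≡q              = b≤b , ≤-minimum (does third?)
  to′ (all-distinct t) = f≤t , ≡.subst (true Bool.≤_) (≡.sym (dec-true third? t)) b≤b
  from′ : ∀ {a b c} (third? : Dec Third) → a xor b Bool.≤ c × c Bool.≤ (a xor b) ∨ (a ∧ b) ∧ does third? →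
          Triangle Third a b c
  from′ {false} {false} {false} _       _        = all-equal
  from′ {false} {true}  {true}  _       _        = x≡p
  from′ {true}  {false} {true}  _       _        = p≡q
  from′ {true}  {true}  {false} _       _        = x≡q
  from′ {true}  {true}  {true}  (yes t) _        = all-distinct t
  from′ {true}  {true}  {true}  (no _)  (_ , ())
  from′ {false} {false} {true}  _       (_ , ())
  from′ {false} {true}  {false} _       (() , _)
  from′ {true}  {false} {false} _       (() , _)

Triangle-swap : ∀ {Third a b c} → Triangle Third a b c → Triangle Third a c b
Triangle-swap all-equal        = all-equal
Triangle-swap x≡p              = x≡p
Triangle-swap p≡q              = x≡q
Triangle-swap x≡q              = p≡q
Triangle-swap (all-distinct t) = all-distinct t

Triangle-between : ∀ {Third a b c j b′} → Triangle Third a j c → Triangle Third a b′ c →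
                   j Bool.≤ b → b Bool.≤ b′ → Triangle Third a b c
Triangle-between t _ b≤b _   = t
Triangle-between _ t f≤t b≤b = t

differ : ∀ {k} → Fin k → Fin k → Bool
differ i j = if does (i ≟ j) then outside else inside

differ≡false⇔≡ : ∀ {k} {i j : Fin k} → differ i j ≡ false ⇔ i ≡ j
differ≡false⇔≡ {i = i} {j} with i ≟ j
... | yes i≡j = mk⇔ (const i≡j) (const ≡.refl)
... | no  i≢j = mk⇔ (λ ()) (⊥-elim ∘ i≢j)

differ-refl : ∀ {k} (i : Fin k) → differ i i ≡ false
differ-refl i = from (differ≡false⇔≡ {i = i}) ≡.refl

≢⇒differ : ∀ {k} {i j : Fin k} → i ≢ j → differ i j ≡ true
≢⇒differ {i = i} {j} i≢j with i ≟ j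
... | yes i≡j = ⊥-elim (i≢j i≡j)
... | no  _   = ≡.refl

differ-≡⇔ : ∀ {k} {i j i′ j′ : Fin k} → differ i j ≡ differ i′ j′ → (i ≡ j ⇔ i′ ≡ j′)
differ-≡⇔ e = mk⇔ (λ i≡j → to differ≡false⇔≡ (≡.trans (≡.sym e) (from differ≡false⇔≡ i≡j)))
                  (λ i′≡j′ → to differ≡false⇔≡ (≡.trans e (from differ≡false⇔≡ i′≡j′)))

distinct³⇒2< : ∀ {k} {i j l : Fin k} → i ≢ j → j ≢ l → i ≢ l → 2 < k
distinct³⇒2< {ℕ.suc (ℕ.suc (ℕ.suc _))} _ _ _ = s≤s (s≤s (s≤s z≤n))
distinct³⇒2< {1} {zero}     {zero}                 i≢j _   _   = ⊥-elim (i≢j ≡.refl)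
distinct³⇒2< {2} {zero}     {zero}                 i≢j _   _   = ⊥-elim (i≢j ≡.refl)
distinct³⇒2< {2} {suc zero} {suc zero}             i≢j _   _   = ⊥-elim (i≢j ≡.refl)
distinct³⇒2< {2} {zero}     {suc zero} {zero}      _   _   i≢l = ⊥-elim (i≢l ≡.refl)
distinct³⇒2< {2} {zero}     {suc zero} {suc zero}  _   j≢l _   = ⊥-elim (j≢l ≡.refl)
distinct³⇒2< {2} {suc zero} {zero}     {zero}      _   j≢l _   = ⊥-elim (j≢l ≡.refl)
distinct³⇒2< {2} {suc zero} {zero}     {suc zero}  _   _   i≢l = ⊥-elim (i≢l ≡.refl)

Triangle-differ : ∀ {k} (i j l : Fin k) → Triangle (2 < k) (differ i j) (differ j l) (differ i l)
Triangle-differ i j l with i ≟ j | j ≟ l | i ≟ l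
... | yes _   | yes _   | yes _   = all-equal
... | yes _   | no _    | no _    = x≡p
... | no _    | yes _   | no _    = p≡q
... | no _    | no _    | yes _   = x≡q
... | no i≢j  | no j≢l  | no i≢l  = all-distinct (distinct³⇒2< i≢j j≢l i≢l)
... | yes i≡j | yes j≡l | no i≢l  = ⊥-elim (i≢l (≡.trans i≡j j≡l))
... | yes i≡j | no j≢l  | yes i≡l = ⊥-elim (j≢l (≡.trans (≡.sym i≡j) i≡l))
... | no i≢j  | yes j≡l | yes i≡l = ⊥-elim (i≢j (≡.trans i≡l (≡.sym j≡l)))

another : ∀ {k} → 2 ≤ k → (i : Fin k) → ∃ λ j → i ≢ j
another (s≤s (s≤s z≤n)) i = punchIn i zero , punchInᵢ≢i i zero ∘ ≡.sym

two-others : ∀ {k} → 2 < k → (i : Fin k) → ∃₂ λ j l → i ≢ j × j ≢ l × i ≢ l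
two-others (s≤s (s≤s (s≤s z≤n))) i =
  punchIn i zero , punchIn i (suc zero) ,
  punchInᵢ≢i i zero ∘ ≡.sym , (λ ()) ∘ punchIn-injective i zero (suc zero) , punchInᵢ≢i i (suc zero) ∘ ≡.sym

Triangle-realised : ∀ {k a b c} → 2 ≤ k → Triangle (2 < k) a b c → (i : Fin k) →
                    ∃₂ λ j l → differ i j ≡ a × differ j l ≡ b × differ i l ≡ c
Triangle-realised _ all-equal i = i , i , differ-refl i , differ-refl i , differ-refl i
Triangle-realised two x≡p i =
  let j , i≢j = another two i in i , j , differ-refl i , ≢⇒differ i≢j , ≢⇒differ i≢j
Triangle-realised two p≡q i =
  let j , i≢j = another two i in j , j , ≢⇒differ i≢j , differ-refl j , ≢⇒differ i≢j
Triangle-realised two x≡q i =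
  let j , i≢j = another two i in j , i , ≢⇒differ i≢j , ≢⇒differ (i≢j ∘ ≡.sym) , differ-refl i
Triangle-realised _ (all-distinct 2<k) i =
  let j , l , i≢j , j≢l , i≢l = two-others 2<k i in j , l , ≢⇒differ i≢j , ≢⇒differ j≢l , ≢⇒differ i≢l

transpose-source : ∀ {k} (i j : Fin k) → PC.transpose i j i ≡ j
transpose-source i j with i ≟ i
... | yes _   = ≡.refl
... | no  i≢i = ⊥-elim (i≢i ≡.refl)

transpose-fix : ∀ {k} {i j l : Fin k} → (l ≡ i ⇔ l ≡ j) → PC.transpose i j l ≡ l
transpose-fix {i = i} {j} {l} l≡i⇔l≡j with l ≟ i
... | yes l≡i = ≡.sym (to l≡i⇔l≡j l≡i)
... | no  l≢i with l ≟ j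
...   | yes l≡j = ⊥-elim (l≢i (from l≡i⇔l≡j l≡j))
...   | no  _   = ≡.refl

⟨$⟩ʳ-injective : ∀ {k} (π : Permutation′ k) {i j} → π ⟨$⟩ʳ i ≡ π ⟨$⟩ʳ j → i ≡ j
⟨$⟩ʳ-injective π e = ≡.trans (≡.sym (inverseˡ π)) (≡.trans (≡.cong (π ⟨$⟩ˡ_) e) (inverseˡ π))

stabiliser-transitive : ∀ {k} {i p q p′ q′ : Fin k} → (i ≡ p ⇔ i ≡ p′) → (p ≡ q ⇔ p′ ≡ q′) → (i ≡ q ⇔ i ≡ q′) →
                        ∃ λ (π : Permutation′ k) → π ⟨$⟩ʳ i ≡ i × π ⟨$⟩ʳ p ≡ p′ × π ⟨$⟩ʳ q ≡ q′
stabiliser-transitive {k} {i} {p} {q} {p′} {q′} i≡p⇔ p≡q⇔ i≡q⇔ =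
  τ₁ ∘ₚ τ₂ , ≡.trans (≡.cong (τ₂ ⟨$⟩ʳ_) τ₁i≡i) (transpose-fix i≡r⇔) ,
  ≡.trans (≡.cong (τ₂ ⟨$⟩ʳ_) τ₁p≡p′) (transpose-fix p′≡r⇔) , transpose-source r q′
  where
  τ₁ τ₂ : Permutation′ k
  r : Fin k
  τ₁ = transpose p p′
  r  = τ₁ ⟨$⟩ʳ q
  τ₂ = transpose r q′
  τ₁i≡i : τ₁ ⟨$⟩ʳ i ≡ i
  τ₁i≡i = transpose-fix i≡p⇔
  τ₁p≡p′ : τ₁ ⟨$⟩ʳ p ≡ p′
  τ₁p≡p′ = transpose-source p p′
  i≡r⇔ : i ≡ r ⇔ i ≡ q′
  i≡r⇔ = mk⇔ (λ e → to i≡q⇔ (⟨$⟩ʳ-injective τ₁ (≡.trans τ₁i≡i e)))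
             (λ e → ≡.trans (≡.sym τ₁i≡i) (≡.cong (τ₁ ⟨$⟩ʳ_) (from i≡q⇔ e)))
  p′≡r⇔ : p′ ≡ r ⇔ p′ ≡ q′
  p′≡r⇔ = mk⇔ (λ e → to p≡q⇔ (⟨$⟩ʳ-injective τ₁ (≡.trans τ₁p≡p′ e)))
              (λ e → ≡.trans (≡.sym τ₁p≡p′) (≡.cong (τ₁ ⟨$⟩ʳ_) (from p≡q⇔ e)))

⊆⇒lookup-≤ : ∀ {m} {s t : Subset m} → s ⊆ t → ∀ k → lookup s k Bool.≤ lookup t k
⊆⇒lookup-≤ {s = s} s⊆t k with lookup s k in sₖ
... | false = ≤-minimum _
... | true  = ≡.subst (true Bool.≤_) (≡.sym ([]=⇒lookup (s⊆t (lookup⇒[]= k s sₖ)))) b≤b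

lookup-≤⇒⊆ : ∀ {m} {s t : Subset m} → (∀ k → lookup s k Bool.≤ lookup t k) → s ⊆ t
lookup-≤⇒⊆ {t = t} s≤t {k} k∈s with lookup t k in tₖ | ≡.subst (Bool._≤ lookup t k) ([]=⇒lookup k∈s) (s≤t k)
... | true  | _  = lookup⇒[]= k t tₖ
... | false | ()

⊆∧≢⇒⊂ : ∀ {m} {s t : Subset m} → s ⊆ t → s ≢ t → s ⊂ t
⊆∧≢⇒⊂ {s = []}          {[]}          _   s≢t = ⊥-elim (s≢t ≡.refl)
⊆∧≢⇒⊂ {s = outside ∷ s} {outside ∷ t} s⊆t s≢t = to out⊂out-⇔ (⊆∧≢⇒⊂ (drop-∷-⊆ s⊆t) (s≢t ∘ ≡.cong (outside ∷_)))
⊆∧≢⇒⊂ {s = outside ∷ s} {inside ∷ t}  s⊆t _   = out⊂in (drop-∷-⊆ s⊆t)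
⊆∧≢⇒⊂ {s = inside ∷ s}  {outside ∷ t} s⊆t _   = case s⊆t here of λ ()
⊆∧≢⇒⊂ {s = inside ∷ s}  {inside ∷ t}  s⊆t s≢t = in⊂in (⊆∧≢⇒⊂ (drop-∷-⊆ s⊆t) (s≢t ∘ ≡.cong (inside ∷_)))

lookup-symdiff : ∀ {m} (s t : Subset m) k → lookup ((s ─ t) ∪ (t ─ s)) k ≡ lookup s k xor lookup t k
lookup-symdiff (false ∷ _) (false ∷ _) zero    = ≡.refl
lookup-symdiff (false ∷ _) (true ∷ _)  zero    = ≡.refl
lookup-symdiff (true ∷ _)  (false ∷ _) zero    = ≡.refl
lookup-symdiff (true ∷ _)  (true ∷ _)  zero    = ≡.refl
lookup-symdiff (_ ∷ s)     (_ ∷ t)     (suc k) = lookup-symdiff s t k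

module Scheme {c ℓ : Level} (F : Field c ℓ) (n : ℕ) (u : Fin n → ℕ) where

  open Field F hiding (zero)
  open FAS F n u
  open import Relation.Binary.Reasoning.Setoid setoid
  open CommutativeMonoidSum +-commutativeMonoid using (sum; sum-permute)
  open CommutativeSemigroupProperties +-commutativeSemigroup using (interchange)
  open CommutativeSemigroupProperties *-commutativeSemigroup using (x∙yz≈y∙xz)

  _≟ₛ_ : ∀ {m} → DecidableEquality (Subset m)
  _≟ₛ_ = ≡-dec _≟ᵇ_

  sumFin-cong : ∀ m {f g : Fin m → Carrier} → (∀ k → f k ≈ g k) → sumFin m f ≈ sumFin m g
  sumFin-cong ℕ.zero    f≈g = refl
  sumFin-cong (ℕ.suc m) f≈g = +-cong (f≈g zero) (sumFin-cong m (f≈g ∘ suc))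

  sumFin-zero : ∀ m {f : Fin m → Carrier} → (∀ k → f k ≈ 0#) → sumFin m f ≈ 0#
  sumFin-zero ℕ.zero    f≈0 = refl
  sumFin-zero (ℕ.suc m) f≈0 = trans (+-cong (f≈0 zero) (sumFin-zero m (f≈0 ∘ suc))) (+-identityʳ 0#)

  sumFin-δ : ∀ {m} {f : Fin m → Carrier} {y} (k₀ : Fin m) → f k₀ ≈ y → (∀ k → k ≢ k₀ → f k ≈ 0#) → sumFin m f ≈ y
  sumFin-δ {ℕ.suc m} {y = y} zero     fk₀≈y rest =
    trans (+-cong fk₀≈y (sumFin-zero m (λ k → rest (suc k) λ ()))) (+-identityʳ y)
  sumFin-δ {ℕ.suc m} {y = y} (suc k₀) fk₀≈y rest =
    trans (+-cong (rest zero λ ()) (sumFin-δ k₀ fk₀≈y (λ k k≢k₀ → rest (suc k) (k≢k₀ ∘ suc-injective)))) (+-identityˡ y)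

  sumFin≈sum : ∀ m (f : Fin m → Carrier) → sumFin m f ≈ sum f
  sumFin≈sum ℕ.zero    f = refl
  sumFin≈sum (ℕ.suc m) f = +-cong refl (sumFin≈sum m (f ∘ suc))

  sumFin-permute : ∀ m (π : Permutation′ m) (f : Fin m → Carrier) → sumFin m (f ∘ (π ⟨$⟩ʳ_)) ≈ sumFin m f
  sumFin-permute m π f = begin
    sumFin m (f ∘ (π ⟨$⟩ʳ_)) ≈⟨ sumFin≈sum m _ ⟩
    sum (f ∘ (π ⟨$⟩ʳ_))      ≈⟨ sum-permute f π ⟨
    sum f                    ≈⟨ sumFin≈sum m f ⟨
    sumFin m f               ∎

  sumΠ-zero : ∀ m (v : Fin m → ℕ) {f : ((a : Fin m) → Fin (v a)) → Carrier} → (∀ w → f w ≈ 0#) → sumΠ m v f ≈ 0#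
  sumΠ-zero ℕ.zero    v f≈0 = f≈0 _
  sumΠ-zero (ℕ.suc m) v f≈0 = sumFin-zero (v zero) (λ _ → sumΠ-zero m (v ∘ suc) (λ _ → f≈0 _))

  sumΠ-δ : ∀ m (v : Fin m → ℕ) {f : ((a : Fin m) → Fin (v a)) → Carrier} {y} (w₀ : (a : Fin m) → Fin (v a)) →
           (∀ w → (∀ a → w a ≡ w₀ a) → f w ≈ y) → (∀ w → ¬ (∀ a → w a ≡ w₀ a) → f w ≈ 0#) → sumΠ m v f ≈ y
  sumΠ-δ ℕ.zero    v w₀ at-w₀ _    = at-w₀ _ (λ ())
  sumΠ-δ (ℕ.suc m) v w₀ at-w₀ rest =
    sumFin-δ (w₀ zero)
      (sumΠ-δ m (v ∘ suc) (w₀ ∘ suc)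
        (λ w w≐ → at-w₀ _ λ { zero → ≡.refl ; (suc a) → w≐ a })
        (λ w w≭ → rest _ λ w≐ → w≭ (w≐ ∘ suc)))
      (λ k k≢ → sumΠ-zero m (v ∘ suc) (λ w → rest _ λ w≐ → k≢ (w≐ zero)))

  -- Stated for pointwise equal arguments: without function extensionality, σ ⟨$⟩ (k ∷ w) and
  -- (σ₀ k) ∷ (σ′ ⟨$⟩ w) are different functions.
  sumΠ-permute : ∀ m (v : Fin m → ℕ) (σ : (a : Fin m) → Permutation′ (v a)) {f g : ((a : Fin m) → Fin (v a)) → Carrier} →
                 (∀ w w′ → (∀ a → w′ a ≡ σ a ⟨$⟩ʳ w a) → g w′ ≈ f w) → sumΠ m v g ≈ sumΠ m v f
  sumΠ-permute ℕ.zero    v σ g≈f = g≈f _ _ (λ ())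
  sumΠ-permute (ℕ.suc m) v σ g≈f =
    trans (sym (sumFin-permute (v zero) (σ zero) _))
      (sumFin-cong (v zero) λ k →
        sumΠ-permute m (v ∘ suc) (σ ∘ suc) λ w w′ w′≐ → g≈f _ _ λ { zero → ≡.refl ; (suc a) → w′≐ a })

  sumSub-cong : ∀ m {f g : Subset m → Carrier} → (∀ s → f s ≈ g s) → sumSub m f ≈ sumSub m g
  sumSub-cong ℕ.zero    f≈g = f≈g []
  sumSub-cong (ℕ.suc m) f≈g = +-cong (sumSub-cong m (f≈g ∘ (outside ∷_))) (sumSub-cong m (f≈g ∘ (inside ∷_)))

  sumSub-zero : ∀ m {f : Subset m → Carrier} → (∀ s → f s ≈ 0#) → sumSub m f ≈ 0#
  sumSub-zero ℕ.zero    f≈0 = f≈0 []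
  sumSub-zero (ℕ.suc m) f≈0 =
    trans (+-cong (sumSub-zero m (f≈0 ∘ (outside ∷_))) (sumSub-zero m (f≈0 ∘ (inside ∷_)))) (+-identityʳ 0#)

  sumSub-δ : ∀ {m} {f : Subset m → Carrier} {y} (s₀ : Subset m) → f s₀ ≈ y → (∀ s → s ≢ s₀ → f s ≈ 0#) → sumSub m f ≈ y
  sumSub-δ []                 fs₀≈y _    = fs₀≈y
  sumSub-δ {ℕ.suc m} {y = y} (false ∷ s₀) fs₀≈y rest =
    trans (+-cong (sumSub-δ s₀ fs₀≈y λ s s≢ → rest (false ∷ s) (s≢ ∘ ∷-injectiveʳ))
                  (sumSub-zero m λ s → rest (true ∷ s) λ ())) (+-identityʳ y)
  sumSub-δ {ℕ.suc m} {y = y} (true ∷ s₀) fs₀≈y rest =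
    trans (+-cong (sumSub-zero m λ s → rest (false ∷ s) λ ())
                  (sumSub-δ s₀ fs₀≈y λ s s≢ → rest (true ∷ s) (s≢ ∘ ∷-injectiveʳ))) (+-identityˡ y)

  sumSub-distrib-+ : ∀ m (f g : Subset m → Carrier) → sumSub m (λ s → f s + g s) ≈ sumSub m f + sumSub m g
  sumSub-distrib-+ ℕ.zero    f g = refl
  sumSub-distrib-+ (ℕ.suc m) f g = trans (+-cong (sumSub-distrib-+ m _ _) (sumSub-distrib-+ m _ _)) (interchange _ _ _ _)

  *-distribˡ-sumSub : ∀ m y (f : Subset m → Carrier) → y * sumSub m f ≈ sumSub m (λ s → y * f s)
  *-distribˡ-sumSub ℕ.zero    y f = refl
  *-distribˡ-sumSub (ℕ.suc m) y f = trans (distribˡ y _ _) (+-cong (*-distribˡ-sumSub m y _) (*-distribˡ-sumSub m y _))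

  *-distribʳ-sumSub : ∀ m y (f : Subset m → Carrier) → sumSub m f * y ≈ sumSub m (λ s → f s * y)
  *-distribʳ-sumSub ℕ.zero    y f = refl
  *-distribʳ-sumSub (ℕ.suc m) y f = trans (distribʳ y _ _) (+-cong (*-distribʳ-sumSub m y _) (*-distribʳ-sumSub m y _))

  sumSub-comm : ∀ m k (f : Subset m → Subset k → Carrier) →
                sumSub m (λ s → sumSub k (f s)) ≈ sumSub k (λ t → sumSub m (λ s → f s t))
  sumSub-comm ℕ.zero    k f = refl
  sumSub-comm (ℕ.suc m) k f =
    trans (+-cong (sumSub-comm m k _) (sumSub-comm m k _)) (sym (sumSub-distrib-+ k _ _))

  -- Möbius inversion on the lattice of subsets

  μ₂ : Bool → Bool → Carrier
  μ₂ false false = 1#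
  μ₂ false true  = - 1#
  μ₂ true  false = 0#
  μ₂ true  true  = 1#

  möbius : ∀ {m} → Subset m → Subset m → Carrier
  möbius []      []      = 1#
  möbius (a ∷ s) (b ∷ t) = μ₂ a b * möbius s t

  möbius-⊈ : ∀ {m} {s t : Subset m} → s ⊈ t → möbius s t ≈ 0#
  möbius-⊈ {s = []}        {[]}        s⊈t = ⊥-elim (s⊈t id)
  möbius-⊈ {s = false ∷ s} {_ ∷ t}     s⊈t = trans (*-congˡ (möbius-⊈ (s⊈t ∘ out⊆))) (zeroʳ _)
  möbius-⊈ {s = true ∷ s}  {false ∷ t} _   = zeroˡ _
  möbius-⊈ {s = true ∷ s}  {true ∷ t}  s⊈t = trans (*-congˡ (möbius-⊈ (s⊈t ∘ in⊆in))) (zeroʳ _)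

  möbius-inversion : ∀ {m} (D t : Subset m) →
                     sumSub m (λ b → indicator (does (D ⊆? b)) * möbius b t) ≈ indicator (does (D ≟ₛ t))
  möbius-inversion []      []      = *-identityʳ 1#
  möbius-inversion {ℕ.suc m} (d ∷ D) (e ∷ t) = by-cases d e
    where
    I : Carrier
    I = indicator (does (D ≟ₛ t))
    scaled : ∀ z → sumSub m (λ b → indicator (does (D ⊆? b)) * (z * möbius b t)) ≈ z * I
    scaled z = begin
      sumSub m (λ b → indicator (does (D ⊆? b)) * (z * möbius b t)) ≈⟨ sumSub-cong m (λ b → x∙yz≈y∙xz _ z _) ⟩
      sumSub m (λ b → z * (indicator (does (D ⊆? b)) * möbius b t)) ≈⟨ *-distribˡ-sumSub m z _ ⟨
      z * sumSub m (λ b → indicator (does (D ⊆? b)) * möbius b t)   ≈⟨ *-congˡ (möbius-inversion D t) ⟩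
      z * I                                                         ∎
    absent : ∀ z → sumSub m (λ b → 0# * (z * möbius b t)) ≈ 0#
    absent z = sumSub-zero m (λ b → zeroˡ _)
    by-cases : ∀ d e → sumSub (ℕ.suc m) (λ b → indicator (does ((d ∷ D) ⊆? b)) * möbius b (e ∷ t))
                         ≈ indicator (does ((d ∷ D) ≟ₛ (e ∷ t)))
    by-cases false false = trans (+-cong (scaled 1#) (scaled 0#))
                             (trans (+-cong (*-identityˡ I) (zeroˡ I)) (+-identityʳ I))
    by-cases false true  = trans (+-cong (scaled (- 1#)) (scaled 1#))
                             (trans (sym (distribʳ I (- 1#) 1#)) (trans (*-congʳ (-‿inverseˡ 1#)) (zeroˡ I)))
    by-cases true  false = trans (+-cong (absent _) (scaled 0#)) (trans (+-identityˡ _) (zeroˡ I))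
    by-cases true  true  = trans (+-cong (absent _) (scaled 1#)) (trans (+-identityˡ _) (*-identityˡ I))

  lookup-⊙ : ∀ s t k → lookup (s ⊙ t) k ≡ (lookup s k xor lookup t k) ∨ (lookup s k ∧ lookup t k) ∧ does (2 <? u k)
  lookup-⊙ s t k = ≡.trans (lookup-zipWith _∨_ k (s ⊕ t) (tilde (s ∩ t)))
    (≡.cong₂ _∨_ (lookup-symdiff s t k) (≡.trans (lookup∘tabulate _ k) (≡.cong (_∧ _) (lookup-zipWith _∧_ k s t))))

  Cond? : ∀ a b c → Dec (Cond a b c)
  Cond? a b c = ((a ⊕ b) ⊆? c) ×-dec (c ⊆? (a ⊙ b))

  Cond⇔Triangle : ∀ {a b c} → Cond a b c ⇔ (∀ k → Triangle (2 < u k) (lookup a k) (lookup b k) (lookup c k))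
  Cond⇔Triangle {a} {b} {c} = mk⇔ to′ from′
    where
    to′ : Cond a b c → ∀ k → Triangle (2 < u k) (lookup a k) (lookup b k) (lookup c k)
    to′ (a⊕b⊆c , c⊆a⊙b) k = from (Triangle⇔ (2 <? u k))
      ( ≡.subst (Bool._≤ lookup c k) (lookup-symdiff a b k) (⊆⇒lookup-≤ a⊕b⊆c k)
      , ≡.subst (lookup c k Bool.≤_) (lookup-⊙ a b k) (⊆⇒lookup-≤ c⊆a⊙b k))
    from′ : (∀ k → Triangle (2 < u k) (lookup a k) (lookup b k) (lookup c k)) → Cond a b c
    from′ triangles =
        lookup-≤⇒⊆ (λ k → ≡.subst (Bool._≤ lookup c k) (≡.sym (lookup-symdiff a b k))
                            (proj₁ (to (Triangle⇔ (2 <? u k)) (triangles k))))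
      , lookup-≤⇒⊆ (λ k → ≡.subst (lookup c k Bool.≤_) (≡.sym (lookup-⊙ a b k))
                            (proj₂ (to (Triangle⇔ (2 <? u k)) (triangles k))))

  Cond-swap : ∀ {a b c} → Cond a b c → Cond a c b
  Cond-swap abc = from Cond⇔Triangle (Triangle-swap ∘ to Cond⇔Triangle abc)

  Cond-between : ∀ {a b c j b′} → Cond a j c → Cond a b′ c → j ⊆ b → b ⊆ b′ → Cond a b c
  Cond-between ajc ab′c j⊆b b⊆b′ = from Cond⇔Triangle λ k →
    Triangle-between (to Cond⇔Triangle ajc k) (to Cond⇔Triangle ab′c k) (⊆⇒lookup-≤ j⊆b k) (⊆⇒lookup-≤ b⊆b′ k)

  infix 4 _≐_
  _≐_ : X → X → Set
  p ≐ q = ∀ a → p a ≡ q a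

  lookup-diffSet : ∀ p q a → lookup (diffSet p q) a ≡ differ (p a) (q a)
  lookup-diffSet p q = lookup∘tabulate _

  diffSet-≡⇒differ : ∀ p q p′ q′ → diffSet p q ≡ diffSet p′ q′ → ∀ a → differ (p a) (q a) ≡ differ (p′ a) (q′ a)
  diffSet-≡⇒differ p q p′ q′ e a =
    ≡.trans (≡.sym (lookup-diffSet p q a)) (≡.trans (≡.cong (λ s → lookup s a) e) (lookup-diffSet p′ q′ a))

  diffSet-tabulate : ∀ p q {s} → (∀ a → differ (p a) (q a) ≡ lookup s a) → diffSet p q ≡ s
  diffSet-tabulate p q {s} differ≡ = ≡.trans (tabulate-cong differ≡) (tabulate∘lookup s)

  Cond-diffSet : ∀ x p q → Cond (diffSet x p) (diffSet p q) (diffSet x q)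
  Cond-diffSet x p q = from Cond⇔Triangle triangle
    where
    triangle : ∀ a → Triangle (2 < u a) (lookup (diffSet x p) a) (lookup (diffSet p q) a) (lookup (diffSet x q) a)
    triangle a rewrite lookup-diffSet x p a | lookup-diffSet p q a | lookup-diffSet x q a =
      Triangle-differ (x a) (p a) (q a)

  Cond⇒realised : (∀ a → 2 ≤ u a) → ∀ {a b c} → Cond a b c →
                  ∀ x → ∃₂ λ p q → diffSet x p ≡ a × diffSet p q ≡ b × diffSet x q ≡ c
  Cond⇒realised u≥2 {a} {b} {c} abc x =
    p , q , diffSet-tabulate x p (proj₁ ∘ realised) , diffSet-tabulate p q (proj₁ ∘ proj₂ ∘ realised)
          , diffSet-tabulate x q (proj₂ ∘ proj₂ ∘ realised)
    where
    coordinate : ∀ k → ∃₂ λ j l → differ (x k) j ≡ lookup a k × differ j l ≡ lookup b k × differ (x k) l ≡ lookup c k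
    coordinate k = Triangle-realised (u≥2 k) (to Cond⇔Triangle abc k) (x k)
    p q : X
    p k = proj₁ (coordinate k)
    q k = proj₁ (proj₂ (coordinate k))
    realised : ∀ k → differ (x k) (p k) ≡ lookup a k × differ (p k) (q k) ≡ lookup b k × differ (x k) (q k) ≡ lookup c k
    realised k = proj₂ (proj₂ (coordinate k))

  indicator-*-indicator : ∀ β δ y → indicator β * (y * indicator δ) ≈ indicator (β ∧ δ) * y
  indicator-*-indicator false _     y = trans (zeroˡ _) (sym (zeroˡ y))
  indicator-*-indicator true  false y = trans (*-identityˡ _) (trans (zeroʳ y) (sym (zeroˡ y)))
  indicator-*-indicator true  true  y = trans (*-identityˡ _) (trans (*-identityʳ y) (sym (*-identityˡ y)))

  indicator-∧-vanish : ∀ {P Q : Set} (P? : Dec P) (Q? : Dec Q) {y} → (P → Q → y ≈ 0#) →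
                       indicator (does P? ∧ does Q?) * y ≈ 0#
  indicator-∧-vanish (yes p) (yes q) y≈0 = trans (*-identityˡ _) (y≈0 p q)
  indicator-∧-vanish (yes _) (no _)  _   = zeroˡ _
  indicator-∧-vanish (no _)  _       _   = zeroˡ _

  indicator-∧-absorb : ∀ {P Q : Set} (P? : Dec P) (Q? : Dec Q) {y} → (Q → P ⊎ y ≈ 0#) →
                       indicator (does P? ∧ does Q?) * y ≈ indicator (does Q?) * y
  indicator-∧-absorb (yes _)  _       _ = refl
  indicator-∧-absorb (no _)   (no _)  _ = refl
  indicator-∧-absorb (no ¬p)  (yes q) P⊎y≈0 with P⊎y≈0 q
  ... | inj₁ p   = ⊥-elim (¬p p)
  ... | inj₂ y≈0 = trans (zeroˡ _) (sym (trans (*-identityˡ _) y≈0))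

  if≈indicator* : ∀ β y → (if β then y else 0#) ≈ indicator β * y
  if≈indicator* false y = sym (zeroˡ y)
  if≈indicator* true  y = sym (*-identityˡ y)

  eqX-≐ : ∀ {p q} → p ≐ q → eqX p q ≡ true
  eqX-≐ = dec-true (all? _)

  eqX-≭ : ∀ {p q} → ¬ p ≐ q → eqX p q ≡ false
  eqX-≭ = dec-false (all? _)

  diffSet-cong : ∀ {p p′ q q′} → p ≐ p′ → q ≐ q′ → diffSet p q ≡ diffSet p′ q′
  diffSet-cong p≐p′ q≐q′ = tabulate-cong λ a → ≡.cong₂ differ (p≐p′ a) (q≐q′ a)

  inR-self : ∀ p q → inR (diffSet p q) p q ≡ true
  inR-self p q = dec-true (diffSet p q ≟ₛ diffSet p q) ≡.refl

  inR-other : ∀ {g} p q → g ≢ diffSet p q → inR g p q ≡ false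
  inR-other p q g≢ = dec-false (diffSet p q ≟ₛ _) (g≢ ∘ ≡.sym)

  ⊕⊆diffSet : ∀ x p q → diffSet x p ⊕ diffSet x q ⊆ diffSet p q
  ⊕⊆diffSet x p q = proj₁ (Cond-swap (Cond-diffSet x p q))

  module _ (x : X) where

    E*-*M : ∀ g (M : Mat) p q → (∀ r → r ≐ p → M r q ≈ M p q) →
            (E* x g *M M) p q ≈ indicator (inR g x p) * M p q
    E*-*M g M p q M-resp = sumΠ-δ n u p
      (λ r r≐p → *-cong (reflexive (≡.cong (λ β → indicator (β ∧ inR g x p)) (eqX-≐ (≡.sym ∘ r≐p)))) (M-resp r r≐p))
      (λ r r≭p → trans (*-congʳ (reflexive (≡.cong (λ β → indicator (β ∧ inR g x p)) (eqX-≭ (r≭p ∘ (≡.sym ∘_))))))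
                       (zeroˡ _))

    *M-E* : ∀ g (M : Mat) p q → (∀ r → r ≐ q → M p r ≈ M p q) →
            (M *M E* x g) p q ≈ M p q * indicator (inR g x q)
    *M-E* g M p q M-resp = sumΠ-δ n u q
      (λ r r≐q → *-cong (M-resp r r≐q) (reflexive (≡.cong₂ (λ β γ → indicator (β ∧ γ))
        (eqX-≐ r≐q) (≡.cong (λ s → does (s ≟ₛ g)) (diffSet-cong {x} {x} (λ _ → ≡.refl) r≐q)))))
      (λ r r≭q → trans (*-congˡ (reflexive (≡.cong (λ β → indicator (β ∧ inR g x r)) (eqX-≭ r≭q)))) (zeroʳ _))

    A-cong : ∀ j {p p′ q q′} → p ≐ p′ → q ≐ q′ → A j p q ≈ A j p′ q′
    A-cong j p≐p′ q≐q′ = reflexive (≡.cong (λ s → indicator (does (s ≟ₛ j))) (diffSet-cong p≐p′ q≐q′))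

    E*AE*-entry : ∀ a j c p q →
                  ((E* x a *M A j) *M E* x c) p q ≈ (indicator (inR a x p) * A j p q) * indicator (inR c x q)
    E*AE*-entry a j c p q = trans (*M-E* c (E* x a *M A j) p q E*A-resp) (*-congʳ (E*A-entry q))
      where
      E*A-entry : ∀ r → (E* x a *M A j) p r ≈ indicator (inR a x p) * A j p r
      E*A-entry r = E*-*M a (A j) p r (λ r′ r′≐p → A-cong j {q = r} {r} r′≐p (λ _ → ≡.refl))
      E*A-resp : ∀ r → r ≐ q → (E* x a *M A j) p r ≈ (E* x a *M A j) p q
      E*A-resp r r≐q = trans (E*A-entry r) (trans (*-congˡ (A-cong j {p} {p} (λ _ → ≡.refl) r≐q)) (sym (E*A-entry q)))

    -- The lower bound a ⊕ c ⊆ j in the definition of B is automatic where E* x a and E* x c do not vanish.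
    B-entry : ∀ a b c p q → B x a b c p q ≈ indicator (inR a x p ∧ inR c x q ∧ does (diffSet p q ⊆? b))
    B-entry a b c p q = trans (sumSub-δ D at-D off-D) (collapse (diffSet x p ≟ₛ a) (diffSet x q ≟ₛ c))
      where
      D : Subset n
      D = diffSet p q
      β : Subset n → Bool
      β j = does ((a ⊕ c) ⊆? j) ∧ does (j ⊆? b)
      at-D : (if β D then ((E* x a *M A D) *M E* x c) p q else 0#) ≈
             indicator (β D) * (indicator (inR a x p) * indicator (inR c x q))
      at-D = trans (if≈indicator* (β D) _) (*-congˡ (trans (E*AE*-entry a D c p q)
               (*-congʳ (trans (*-congˡ (reflexive (≡.cong indicator (inR-self p q)))) (*-identityʳ _)))))
      off-D : ∀ j → j ≢ D → (if β j then ((E* x a *M A j) *M E* x c) p q else 0#) ≈ 0#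
      off-D j j≢D = trans (if≈indicator* (β j) _) (trans (*-congˡ (trans (E*AE*-entry a j c p q)
        (trans (*-congʳ (trans (*-congˡ Ajpq≈0) (zeroʳ _))) (zeroˡ _)))) (zeroʳ _))
        where
        Ajpq≈0 : A j p q ≈ 0#
        Ajpq≈0 = reflexive (≡.cong indicator (inR-other p q j≢D))
      collapse : (α? : Dec (diffSet x p ≡ a)) (γ? : Dec (diffSet x q ≡ c)) →
                 indicator (β D) * (indicator (does α?) * indicator (does γ?)) ≈
                 indicator (does α? ∧ does γ? ∧ does (D ⊆? b))
      collapse (yes ≡.refl) (yes ≡.refl) = trans (*-congˡ (*-identityˡ 1#)) (trans (*-identityʳ _)
        (reflexive (≡.cong (λ ε → indicator (ε ∧ does (D ⊆? b))) (dec-true (_ ⊆? D) (⊕⊆diffSet x p q)))))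
      collapse (yes _) (no _) = trans (*-congˡ (zeroʳ _)) (zeroʳ _)
      collapse (no _)  _      = trans (*-congˡ (zeroˡ _)) (zeroʳ _)

    linComb-entry : ∀ coef {p q a d c} → diffSet x p ≡ a → diffSet p q ≡ d → diffSet x q ≡ c →
                    linComb x coef p q ≈ sumSub n (λ b → indicator (cond a b c ∧ does (d ⊆? b)) * coef a b c)
    linComb-entry coef {p} {q} ≡.refl ≡.refl ≡.refl = sumSub-δ P (sumSub-cong n at-P) off-P
      where
      P C D : Subset n
      P = diffSet x p
      C = diffSet x q
      D = diffSet p q
      term : Subset n → Subset n → Subset n → Carrier
      term a b c = (if cond a b c then coef a b c ·M B x a b c else 0M) p q
      term-entry : ∀ a b c →
                   term a b c ≈ indicator (cond a b c) * (coef a b c * indicator (inR a x p ∧ inR c x q ∧ does (D ⊆? b)))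
      term-entry a b c with cond a b c
      ... | true  = trans (*-congˡ (B-entry a b c p q)) (sym (*-identityˡ _))
      ... | false = sym (zeroˡ _)
      vanishes : ∀ a b c → (inR a x p ∧ inR c x q ∧ does (D ⊆? b)) ≡ false → term a b c ≈ 0#
      vanishes a b c ≡false = trans (term-entry a b c)
        (trans (*-congˡ (trans (*-congˡ (reflexive (≡.cong indicator ≡false))) (zeroʳ _))) (zeroʳ _))
      at-P : ∀ b → sumSub n (term P b) ≈ indicator (cond P b C ∧ does (D ⊆? b)) * coef P b C
      at-P b = sumSub-δ C
        (trans (term-entry P b C) (trans
          (*-congˡ (*-congˡ (reflexive (≡.cong₂ (λ α γ → indicator (α ∧ γ ∧ does (D ⊆? b)))
            (inR-self x p) (inR-self x q)))))
          (indicator-*-indicator (cond P b C) (does (D ⊆? b)) (coef P b C))))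
        (λ c c≢C → vanishes P b c (≡.cong₂ _∧_ (inR-self x p) (≡.cong (_∧ _) (inR-other x q c≢C))))
      off-P : ∀ a → a ≢ P → sumSub n (λ b → sumSub n (term a b)) ≈ 0#
      off-P a a≢P = sumSub-zero n λ b → sumSub-zero n λ c → vanishes a b c (≡.cong (_∧ _) (inR-other x p a≢P))

    InT-sumSub : ∀ m (G : Subset m → Mat) → (∀ j → InT x (G j)) → InT x (λ p q → sumSub m (λ j → G j p q))
    InT-sumSub ℕ.zero    G G∈T = G∈T []
    InT-sumSub (ℕ.suc m) G G∈T =
      add (InT-sumSub m (G ∘ (outside ∷_)) (G∈T ∘ (outside ∷_))) (InT-sumSub m (G ∘ (inside ∷_)) (G∈T ∘ (inside ∷_)))

    InT-if : ∀ β {M} → InT x M → InT x (λ p q → if β then M p q else 0#)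
    InT-if true  M∈T = M∈T
    InT-if false _   = zer

    B∈T : ∀ a b c → InT x (B x a b c)
    B∈T a b c = InT-sumSub n _ λ j → InT-if (does ((a ⊕ c) ⊆? j) ∧ does (j ⊆? b)) (mul (mul (genE a) (genA j)) (genE c))

    B-type-entry : ∀ {a b c p q} → diffSet x p ≡ a → diffSet p q ≡ b → diffSet x q ≡ c → B x a b c p q ≈ 1#
    B-type-entry {p = p} {q} ≡.refl ≡.refl ≡.refl = trans (B-entry _ _ _ p q) (reflexive (≡.cong indicator
      (≡.cong₂ _∧_ (inR-self x p) (≡.cong₂ _∧_ (inR-self x q) (dec-true (diffSet p q ⊆? diffSet p q) ⊆-refl)))))

    B≈1⇒type : ∀ {a b c p q} → B x a b c p q ≈ 1# → diffSet x p ≡ a × diffSet p q ⊆ b × diffSet x q ≡ c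
    B≈1⇒type {a} {b} {c} {p} {q} B≈1 =
      from-indicator (diffSet x p ≟ₛ a) (diffSet x q ≟ₛ c) (diffSet p q ⊆? b) (trans (sym (B-entry a b c p q)) B≈1)
      where
      from-indicator : (α? : Dec (diffSet x p ≡ a)) (γ? : Dec (diffSet x q ≡ c)) (δ? : Dec (diffSet p q ⊆ b)) →
                       indicator (does α? ∧ does γ? ∧ does δ?) ≈ 1# → diffSet x p ≡ a × diffSet p q ⊆ b × diffSet x q ≡ c
      from-indicator (yes α) (yes γ) (yes δ) _   = α , δ , γ
      from-indicator (yes _) (yes _) (no _)  0≈1 = ⊥-elim (0≉1 0≈1)
      from-indicator (yes _) (no _)  _       0≈1 = ⊥-elim (0≉1 0≈1)
      from-indicator (no _)  _       _       0≈1 = ⊥-elim (0≉1 0≈1)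

  möbius-inversion-Cond : ∀ {a c d b′} → Cond a d c → Cond a b′ c →
                          sumSub n (λ b → indicator (cond a b c ∧ does (d ⊆? b)) * möbius b b′) ≈ indicator (does (d ≟ₛ b′))
  möbius-inversion-Cond {a} {c} {d} {b′} adc ab′c =
    trans (sumSub-cong n λ b → indicator-∧-absorb (Cond? a b c) (d ⊆? b) (between b)) (möbius-inversion d b′)
    where
    between : ∀ b → d ⊆ b → Cond a b c ⊎ möbius b b′ ≈ 0#
    between b d⊆b with b ⊆? b′
    ... | yes b⊆b′ = inj₁ (Cond-between adc ab′c d⊆b b⊆b′)
    ... | no  b⊈b′ = inj₂ (möbius-⊈ b⊈b′)

  -- Invariance of T under the stabiliser of x

  Perm : Set
  Perm = (a : Fin n) → Permutation′ (u a)

  infixr 5 _⟨$⟩_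
  _⟨$⟩_ : Perm → X → X
  (σ ⟨$⟩ p) a = σ a ⟨$⟩ʳ p a

  permute-≡⇔ : ∀ σ {p q p′ q′} → p′ ≐ σ ⟨$⟩ p → q′ ≐ σ ⟨$⟩ q → ∀ a → (p′ a ≡ q′ a ⇔ p a ≡ q a)
  permute-≡⇔ σ p′≐ q′≐ a =
    mk⇔ (λ e → ⟨$⟩ʳ-injective (σ a) (≡.trans (≡.sym (p′≐ a)) (≡.trans e (q′≐ a))))
        (λ e → ≡.trans (p′≐ a) (≡.trans (≡.cong (σ a ⟨$⟩ʳ_) e) (≡.sym (q′≐ a))))

  diffSet-permute : ∀ σ {p q p′ q′} → p′ ≐ σ ⟨$⟩ p → q′ ≐ σ ⟨$⟩ q → diffSet p′ q′ ≡ diffSet p q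
  diffSet-permute σ {p} {q} {p′} {q′} p′≐ q′≐ = tabulate-cong λ a →
    ≡.cong (λ β → if β then outside else inside) (does-⇔ (permute-≡⇔ σ p′≐ q′≐ a) (p′ a ≟ q′ a) (p a ≟ q a))

  eqX-permute : ∀ σ {p q p′ q′} → p′ ≐ σ ⟨$⟩ p → q′ ≐ σ ⟨$⟩ q → eqX p′ q′ ≡ eqX p q
  eqX-permute σ p′≐ q′≐ = does-⇔
    (mk⇔ (λ p′≐q′ a → to (permute-≡⇔ σ p′≐ q′≐ a) (p′≐q′ a)) (λ p≐q a → from (permute-≡⇔ σ p′≐ q′≐ a) (p≐q a)))
    (all? _) (all? _)

  module _ (x : X) where

    Invariant : Mat → Set ℓ
    Invariant M = ∀ σ → x ≐ σ ⟨$⟩ x → ∀ {p q p′ q′} → p′ ≐ σ ⟨$⟩ p → q′ ≐ σ ⟨$⟩ q → M p′ q′ ≈ M p q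

    InT⇒Invariant : ∀ {M} → InT x M → Invariant M
    InT⇒Invariant (genA g) σ _ p′≐ q′≐ =
      reflexive (≡.cong (λ s → indicator (does (s ≟ₛ g))) (diffSet-permute σ p′≐ q′≐))
    InT⇒Invariant (genE g) σ x≐ p′≐ q′≐ = reflexive (≡.cong₂ (λ β γ → indicator (β ∧ γ))
      (eqX-permute σ p′≐ q′≐) (≡.cong (λ s → does (s ≟ₛ g)) (diffSet-permute σ x≐ p′≐)))
    InT⇒Invariant one σ _ p′≐ q′≐ = reflexive (≡.cong indicator (eqX-permute σ p′≐ q′≐))
    InT⇒Invariant zer _ _ _ _ = refl
    InT⇒Invariant (add M∈T N∈T) σ x≐ p′≐ q′≐ =
      +-cong (InT⇒Invariant M∈T σ x≐ p′≐ q′≐) (InT⇒Invariant N∈T σ x≐ p′≐ q′≐)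
    InT⇒Invariant (scal s M∈T) σ x≐ p′≐ q′≐ = *-congˡ (InT⇒Invariant M∈T σ x≐ p′≐ q′≐)
    InT⇒Invariant (mul M∈T N∈T) σ x≐ p′≐ q′≐ = sumΠ-permute n u σ λ r r′ r′≐ →
      *-cong (InT⇒Invariant M∈T σ x≐ p′≐ r′≐) (InT⇒Invariant N∈T σ x≐ r′≐ q′≐)
    InT⇒Invariant (resp M≈N M∈T) σ x≐ p′≐ q′≐ =
      trans (sym (M≈N _ _)) (trans (InT⇒Invariant M∈T σ x≐ p′≐ q′≐) (M≈N _ _))

    same-type⇒permutation : ∀ {p q p′ q′} → diffSet x p ≡ diffSet x p′ → diffSet p q ≡ diffSet p′ q′ →
                            diffSet x q ≡ diffSet x q′ → ∃ λ σ → x ≐ σ ⟨$⟩ x × p′ ≐ σ ⟨$⟩ p × q′ ≐ σ ⟨$⟩ q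
    same-type⇒permutation {p} {q} {p′} {q′} xp≡ pq≡ xq≡ =
      proj₁ ∘ moves , ≡.sym ∘ proj₁ ∘ proj₂ ∘ moves , ≡.sym ∘ proj₁ ∘ proj₂ ∘ proj₂ ∘ moves
                    , ≡.sym ∘ proj₂ ∘ proj₂ ∘ proj₂ ∘ moves
      where
      moves : ∀ a → ∃ λ π → π ⟨$⟩ʳ x a ≡ x a × π ⟨$⟩ʳ p a ≡ p′ a × π ⟨$⟩ʳ q a ≡ q′ a
      moves a = stabiliser-transitive (differ-≡⇔ (diffSet-≡⇒differ x p x p′ xp≡ a))
                                      (differ-≡⇔ (diffSet-≡⇒differ p q p′ q′ pq≡ a))
                                      (differ-≡⇔ (diffSet-≡⇒differ x q x q′ xq≡ a))

    InT-type-invariant : ∀ {M p q p′ q′} → InT x M → diffSet x p ≡ diffSet x p′ → diffSet p q ≡ diffSet p′ q′ →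
                         diffSet x q ≡ diffSet x q′ → M p′ q′ ≈ M p q
    InT-type-invariant M∈T xp≡ pq≡ xq≡ =
      let σ , x≐ , p′≐ , q′≐ = same-type⇒permutation xp≡ pq≡ xq≡ in InT⇒Invariant M∈T σ x≐ p′≐ q′≐

  module _ (u≥2 : ∀ a → 2 ≤ u a) (x : X) where

    B≈M⇒ : ∀ {a b c a′ b′ c′} → Cond a b c → B x a b c ≈M B x a′ b′ c′ → a ≡ a′ × b ⊆ b′ × c ≡ c′
    B≈M⇒ {b′ = b′} abc B≈B′ =
      let p , q , xp≡a , pq≡b , xq≡c = Cond⇒realised u≥2 abc x
          xp≡a′ , pq⊆b′ , xq≡c′ = B≈1⇒type x (trans (sym (B≈B′ p q)) (B-type-entry x xp≡a pq≡b xq≡c))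
      in ≡.trans (≡.sym xp≡a) xp≡a′ , ≡.subst (_⊆ b′) pq≡b pq⊆b′ , ≡.trans (≡.sym xq≡c) xq≡c′

    B-injective : ∀ {a b c a′ b′ c′} → Cond a b c → Cond a′ b′ c′ → B x a b c ≈M B x a′ b′ c′ →
                  a ≡ a′ × b ≡ b′ × c ≡ c′
    B-injective abc a′b′c′ B≈B′ =
      let a≡a′ , b⊆b′ , c≡c′ = B≈M⇒ abc B≈B′
          _    , b′⊆b , _    = B≈M⇒ a′b′c′ (λ p q → sym (B≈B′ p q))
      in a≡a′ , ⊆-antisym b⊆b′ b′⊆b , c≡c′

    linComb-independent : ∀ coef → linComb x coef ≈M 0M → ∀ {a b c} → Cond a b c → coef a b c ≈ 0#
    linComb-independent coef combination≈0 {a} {b} {c} = go b (⊃-wellFounded b)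
      where
      go : ∀ b → Acc _⊃_ b → Cond a b c → coef a b c ≈ 0#
      go b (acc larger) abc =
        let p , q , xp≡a , pq≡b , xq≡c = Cond⇒realised u≥2 abc x in
        begin
          coef a b c                                                                 ≈⟨ sumSub-δ b at-b above-b ⟨
          sumSub n (λ b′ → indicator (cond a b′ c ∧ does (b ⊆? b′)) * coef a b′ c)  ≈⟨ linComb-entry x coef xp≡a pq≡b xq≡c ⟨
          linComb x coef p q                                                         ≈⟨ combination≈0 p q ⟩
          0#                                                                         ∎
        where
        at-b : indicator (cond a b c ∧ does (b ⊆? b)) * coef a b c ≈ coef a b c
        at-b = trans (*-congʳ (reflexive (≡.cong indicator
                 (≡.cong₂ _∧_ (dec-true (Cond? a b c) abc) (dec-true (b ⊆? b) ⊆-refl))))) (*-identityˡ _)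
        above-b : ∀ b′ → b′ ≢ b → indicator (cond a b′ c ∧ does (b ⊆? b′)) * coef a b′ c ≈ 0#
        above-b b′ b′≢b = indicator-∧-vanish (Cond? a b′ c) (b ⊆? b′) λ ab′c b⊆b′ →
          go b′ (larger (⊆∧≢⇒⊂ b⊆b′ (b′≢b ∘ ≡.sym))) ab′c

    -- The common value of M ∈ T on the pairs of type (a, b, c), which form one orbit of the stabiliser of x.
    orbitValue : Mat → Subset n → Subset n → Subset n → Carrier
    orbitValue M a b c with Cond? a b c
    ... | yes abc = let p , q , _ = Cond⇒realised u≥2 abc x in M p q
    ... | no  _   = 0#

    orbitValue-type : ∀ {M p q} → InT x M → orbitValue M (diffSet x p) (diffSet p q) (diffSet x q) ≈ M p q
    orbitValue-type {M} {p} {q} M∈T with Cond? (diffSet x p) (diffSet p q) (diffSet x q)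
    ... | yes abc = let _ , _ , xp′≡ , p′q′≡ , xq′≡ = Cond⇒realised u≥2 abc x in
                    InT-type-invariant x M∈T (≡.sym xp′≡) (≡.sym p′q′≡) (≡.sym xq′≡)
    ... | no ¬abc = ⊥-elim (¬abc (Cond-diffSet x p q))

    möbius-orbitValue : ∀ M {a c d} b′ → Cond a d c →
                        sumSub n (λ b → indicator (cond a b c ∧ does (d ⊆? b)) * möbius b b′) * orbitValue M a b′ c ≈
                        indicator (does (d ≟ₛ b′)) * orbitValue M a b′ c
    möbius-orbitValue M {a} {c} b′ adc with Cond? a b′ c
    ... | yes ab′c = *-congʳ (möbius-inversion-Cond adc ab′c)
    ... | no  _    = trans (zeroʳ _) (sym (zeroʳ _))

    spanCoef : Mat → Subset n → Subset n → Subset n → Carrier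
    spanCoef M a b c = sumSub n (λ b′ → möbius b b′ * orbitValue M a b′ c)

    linComb-spanCoef : ∀ {M} → InT x M → ∀ p q → linComb x (spanCoef M) p q ≈ M p q
    linComb-spanCoef {M} M∈T p q = begin
      linComb x (spanCoef M) p q                                      ≈⟨ linComb-entry x (spanCoef M) ≡.refl ≡.refl ≡.refl ⟩
      sumSub n (λ b → w b * sumSub n (λ b′ → möbius b b′ * v b′))     ≈⟨ sumSub-cong n (λ b → *-distribˡ-sumSub n (w b) _) ⟩
      sumSub n (λ b → sumSub n (λ b′ → w b * (möbius b b′ * v b′)))   ≈⟨ sumSub-comm n n _ ⟩
      sumSub n (λ b′ → sumSub n (λ b → w b * (möbius b b′ * v b′)))   ≈⟨ sumSub-cong n (λ b′ → trans
                                                                         (sumSub-cong n λ b → sym (*-assoc _ _ _))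
                                                                         (sym (*-distribʳ-sumSub n (v b′) _))) ⟩
      sumSub n (λ b′ → sumSub n (λ b → w b * möbius b b′) * v b′)     ≈⟨ sumSub-cong n (λ b′ →
                                                                         möbius-orbitValue M b′ (Cond-diffSet x p q)) ⟩
      sumSub n (λ b′ → indicator (does (D ≟ₛ b′)) * v b′)             ≈⟨ sumSub-δ D at-D off-D ⟩
      v D                                                             ≈⟨ orbitValue-type M∈T ⟩
      M p q                                                           ∎
      where
      P C D : Subset n
      P = diffSet x p
      C = diffSet x q
      D = diffSet p q
      v w : Subset n → Carrier
      v b′ = orbitValue M P b′ C
      w b = indicator (cond P b C ∧ does (D ⊆? b))
      at-D : indicator (does (D ≟ₛ D)) * v D ≈ v D
      at-D = trans (*-congʳ (reflexive (≡.cong indicator (dec-true (D ≟ₛ D) ≡.refl)))) (*-identityˡ _)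
      off-D : ∀ b′ → b′ ≢ D → indicator (does (D ≟ₛ b′)) * v b′ ≈ 0#
      off-D b′ b′≢D = trans (*-congʳ (reflexive (≡.cong indicator (dec-false (D ≟ₛ b′) (b′≢D ∘ ≡.sym))))) (zeroˡ _)

    InT⇒span : ∀ {M} → InT x M → ∃ λ coef → M ≈M linComb x coef
    InT⇒span {M} M∈T = spanCoef M , λ p q → sym (linComb-spanCoef M∈T p q)

theorem4p22 : ∀ {c ℓ : Level} (F : Field c ℓ) (n : ℕ) → 1 ≤ n →
  (u : Fin n → ℕ) → (∀ a → 2 ≤ u a) → (x : FAS.X F n u) →
  let open FAS F n u
  in
  -- pairwise distinct
  (∀ a b c a′ b′ c′ → Cond a b c → Cond a′ b′ c′ →
     B x a b c ≈M B x a′ b′ c′ → (a ≡ a′) × (b ≡ b′) × (c ≡ c′))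
  -- contained in T
  × (∀ a b c → Cond a b c → InT x (B x a b c))
  -- linearly independent over F
  × (∀ (coef : Subset n → Subset n → Subset n → Field.Carrier F) →
       linComb x coef ≈M 0M → ∀ a b c → Cond a b c → Field._≈_ F (coef a b c) (Field.0# F))
  -- spanning T
  × (∀ M → InT x M → ∃ λ (coef : Subset n → Subset n → Subset n → Field.Carrier F) →
       M ≈M linComb x coef)
theorem4p22 F n _ u u≥2 x =
    (λ _ _ _ _ _ _ → B-injective u≥2 x)
  , (λ a b c _ → B∈T x a b c)
  , (λ coef combination≈0 _ _ _ → linComb-independent u≥2 x coef combination≈0)
  , (λ _ → InT⇒span u≥2 x)
  where open Scheme F n u
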